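{- For every request sequence $I$, $\mathrm{FIFO}_W(I)\le \mathrm{FWF}_W(I)$ and $\mathrm{LRU}_W(I)\le \mathrm{FWF}_W(I)$.
   Context: Paging: a cache of size $k\ge1$, initially empty; on a request to a page not in cache (a fault) the page is brought in, evicting a page if the cache is full; $\mathrm{A}(I)$ is the number of faults of algorithm $\mathrm{A}$ on $I$. LRU evicts the least recently requested page in cache; FIFO evicts the page that has been in cache the longest; FWF (Flush-When-Full) evicts all pages from the cache whenever a fault occurs while the cache is full. $\mathrm{A}_W(I)=\max_\sigma \mathrm{A}(\sigma(I))$, the maximum over all permutations $\sigma$ of the requests of $I$. -}

module Defs where

open import Data.Nat using (ℕ; zero; suc; _+_; _<?_; _⊔_)
open import Data.Nat.Properties using (_≟_)
open import Data.List using (List; []; _∷_; length; map; concatMap; filter; foldr; _++_; removeAt)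
open import Data.List.Membership.DecPropositional _≟_ using (_∈?_)
open import Relation.Nullary using (yes; no)
open import Relation.Nullary.Decidable using (¬?)
open import Data.Product using (_×_; _,_)

Page : Set
Page = ℕ

Request : Set
Request = List Page

-- Cache contents as a list of pages (no duplicates by construction).
Cache : Set
Cache = List Page

remove : Page → Cache → Cache
remove p = filter (λ q → ¬? (q ≟ p))

dropLast : Cache → Cache
dropLast [] = []
dropLast (x ∷ []) = []
dropLast (x ∷ y ∷ ys) = x ∷ dropLast (y ∷ ys)

-- A paging algorithm: a step function taking the cache size k, the current
-- cache and a requested page, returning the new cache.  (Faults are counted
-- uniformly by `faults`, as the requested page not being in the cache.)
Step : Set
Step = ℕ → Cache → Page → Cache

-- LRU: cache kept in order of most recent request first.
-- Hit: move page to the front. Fault: if full, evict the least recently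
-- requested page (last), then put the new page in front.
lruStep : Step
lruStep k c p with p ∈? c
... | yes _ = p ∷ remove p c
... | no _ with length c <? k
...   | yes _ = p ∷ c
...   | no _  = p ∷ dropLast c

-- FIFO: cache kept in order of insertion, newest first.
-- Hit: unchanged. Fault: if full, evict the oldest (last), insert new page.
fifoStep : Step
fifoStep k c p with p ∈? c
... | yes _ = c
... | no _ with length c <? k
...   | yes _ = p ∷ c
...   | no _  = p ∷ dropLast c

fwfStep : Step
fwfStep k c p with p ∈? c
... | yes _ = c
... | no _ with length c <? k
...   | yes _ = p ∷ c
...   | no _  = p ∷ []

runFaults : Step → ℕ → Cache → Request → ℕ
runFaults A k c [] = 0
runFaults A k c (p ∷ ps) with p ∈? c
... | yes _ = runFaults A k (A k c p) ps
... | no _  = suc (runFaults A k (A k c p) ps)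

faults : Step → ℕ → Request → ℕ
faults A k I = runFaults A k [] I

-- all permutations of a list (as orderings of its positions)
permutations : {A : Set} → List A → List (List A)
permutations {A} xs = go (length xs) xs
  where
  picks : List A → List (A × List A)
  picks [] = []
  picks (y ∷ ys) = (y , ys) ∷ map (λ { (z , zs) → z , y ∷ zs }) (picks ys)
  go : ℕ → List A → List (List A)
  go zero _ = [] ∷ []
  go (suc n) ys = concatMap (λ { (z , zs) → map (z ∷_) (go n zs) }) (picks ys)

maximum : List ℕ → ℕ
maximum = foldr _⊔_ 0

worst : Step → ℕ → Request → ℕ
worst A k I = maximum (map (faults A k) (permutations I))

module Submission where

-- FIFO and LRU never fault more often than FWF, on every request sequence;
-- the worst-order inequalities then follow because FIFO_W, LRU_W and FWF_W
-- all maximise over the same family of permutations.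
--
-- The pointwise inequalities are proved by simulating the two algorithms side
-- by side.  Call a "phase" the stretch since FWF's last flush, and let d be
-- FWF's cache, i.e. the distinct pages requested in the current phase.
--   * The FIFO cache has the form L ++ R, where L lists (distinctly) the
--     pages FIFO loaded during the phase; these all lie in d, so |L| ≤ |d|.
--     Potential argument: FIFO(rest) + |L| ≤ FWF(rest) + |d|.
--   * The LRU cache has the form L ++ R, where L lists exactly the pages of
--     d (without repetitions), so LRU hits whenever FWF hits and
--     LRU(rest) ≤ FWF(rest).
-- In both cases the key fact is that a fault of FIFO or LRU evicts only the
-- last page of a full cache, so a prefix L shorter than k survives a fault.

open import Defs
open import Data.Nat using (ℕ; suc; _+_; _≤_; _≥_; _<_; _<?_; z≤n; s≤s)
open import Data.Nat.Properties
  using (_≟_; ≤-trans; ≤-reflexive; ≤-<-trans; +-suc; +-identityʳ; +-comm;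
         +-mono-≤; +-cancelʳ-≤; m≤n⇒m≤1+n; ⊔-mono-≤)
open import Data.List using (List; []; _∷_; length; map; _++_)
open import Data.List.Properties using (++-identityʳ; filter-++; length-++-sucʳ)
open import Data.List.Membership.Propositional using (_∈_; _∉_)
open import Data.List.Membership.Propositional.Properties
  using (∈-filter⁺; ∈-filter⁻; ∈-++⁺ˡ; ∈-++⁺ʳ; ∈-++⁻; ∈-∃++)
open import Data.List.Membership.DecPropositional _≟_ using (_∈?_)
open import Data.List.Relation.Binary.Subset.Propositional using (_⊆_)
open import Data.List.Relation.Binary.Subset.Propositional.Properties
  using (⊆-refl; ⊆-trans; xs⊆x∷xs; ∷⁺ʳ; ∈-∷⁺ʳ)
open import Data.List.Relation.Unary.Any using (here; there)
open import Data.List.Relation.Unary.All using () renaming (lookup to All-lookup)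
open import Data.List.Relation.Unary.All.Properties using (¬Any⇒All¬)
open import Data.List.Relation.Unary.Unique.Propositional using (Unique; []; _∷_)
open import Data.List.Relation.Unary.Unique.Propositional.Properties using (filter⁺)
open import Relation.Nullary using (yes; no; ¬_; Dec; contradiction)
open import Relation.Nullary.Decidable using (¬?)
open import Relation.Binary.PropositionalEquality
  using (_≡_; _≢_; refl; sym; cong; subst; subst₂)
open import Data.Product using (_×_; ∃; _,_; proj₁; proj₂)
open import Data.Sum using (inj₁; inj₂)

unique-∷ : ∀ {A : Set} {x : A} {xs} → x ∉ xs → Unique xs → Unique (x ∷ xs)
unique-∷ {xs = xs} x∉xs u = ¬Any⇒All¬ xs x∉xs ∷ u

∈-skip : ∀ {A : Set} {x y : A} ys {zs} → y ∈ ys ++ x ∷ zs → y ≢ x → y ∈ ys ++ zs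
∈-skip ys y∈ y≢x with ∈-++⁻ ys y∈
... | inj₁ y∈ys         = ∈-++⁺ˡ y∈ys
... | inj₂ (here y≡x)   = contradiction y≡x y≢x
... | inj₂ (there y∈zs) = ∈-++⁺ʳ ys y∈zs

unique-⊆-length : ∀ {A : Set} {xs ys : List A} → Unique xs → xs ⊆ ys → length xs ≤ length ys
unique-⊆-length {xs = []} _ _ = z≤n
unique-⊆-length {xs = x ∷ xs} (x≢xs ∷ u) xs⊆ys with ∈-∃++ (xs⊆ys (here refl))
... | ys₁ , ys₂ , refl =
  subst (suc (length xs) ≤_) (sym (length-++-sucʳ ys₁ x ys₂))
    (s≤s (unique-⊆-length u (λ y∈xs →
      ∈-skip ys₁ (xs⊆ys (there y∈xs)) (λ y≡x → All-lookup x≢xs y∈xs (sym y≡x)))))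

∈-remove⁻ : ∀ {x p} L → x ∈ remove p L → x ∈ L
∈-remove⁻ {p = p} L x∈ = proj₁ (∈-filter⁻ (λ q → ¬? (q ≟ p)) {xs = L} x∈)

∈-remove⁺ : ∀ {x p} L → x ∈ L → x ≢ p → x ∈ remove p L
∈-remove⁺ {p = p} L x∈ x≢p = ∈-filter⁺ (λ q → ¬? (q ≟ p)) x∈ x≢p

∉-remove : ∀ p L → p ∉ remove p L
∉-remove p L p∈ = proj₂ (∈-filter⁻ (λ q → ¬? (q ≟ p)) {xs = L} p∈) refl

remove-unique : ∀ p {L} → Unique L → Unique (remove p L)
remove-unique p = filter⁺ (λ q → ¬? (q ≟ p))

remove-++ : ∀ p L R → remove p (L ++ R) ≡ remove p L ++ remove p R
remove-++ p = filter-++ (λ q → ¬? (q ≟ p))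

⊆-to-front : ∀ {p L d} → d ⊆ L → d ⊆ p ∷ remove p L
⊆-to-front {p} {L} d⊆L {x} x∈d with x ≟ p
... | yes refl = here refl
... | no x≢p   = there (∈-remove⁺ L (d⊆L x∈d) x≢p)

-- The common fault behaviour of FIFO and LRU: insert the requested page in
-- front, evicting the last page if the cache is full.
admit : ℕ → Cache → Page → Cache
admit k c p with length c <? k
... | yes _ = p ∷ c
... | no _  = p ∷ dropLast c

dropLast-++ : ∀ L r rs → dropLast (L ++ r ∷ rs) ≡ L ++ dropLast (r ∷ rs)
dropLast-++ []          r rs = refl
dropLast-++ (x ∷ [])    r rs = refl
dropLast-++ (x ∷ y ∷ L) r rs = cong (x ∷_) (dropLast-++ (y ∷ L) r rs)

admit-prefix : ∀ k L R p → length L < k → ∃ λ R′ → admit k (L ++ R) p ≡ p ∷ L ++ R′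
admit-prefix k L [] p |L|<k with length (L ++ []) <? k
... | yes _ = [] , refl
... | no full = contradiction (subst (_< k) (sym (cong length (++-identityʳ L))) |L|<k) full
admit-prefix k L (r ∷ rs) p _ with length (L ++ r ∷ rs) <? k
... | yes _ = r ∷ rs , refl
... | no _  = dropLast (r ∷ rs) , cong (p ∷_) (dropLast-++ L r rs)

Admits : Step → Set
Admits A = ∀ k c p → p ∉ c → A k c p ≡ admit k c p

fifo-admits : Admits fifoStep
fifo-admits k c p p∉c with p ∈? c
... | yes p∈c = contradiction p∈c p∉c
... | no _ with length c <? k
...   | yes _ = refl
...   | no _  = refl

lru-admits : Admits lruStep
lru-admits k c p p∉c with p ∈? c
... | yes p∈c = contradiction p∈c p∉c
... | no _ with length c <? k
...   | yes _ = refl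
...   | no _  = refl

fifoStep-hit : ∀ k c p → p ∈ c → fifoStep k c p ≡ c
fifoStep-hit k c p p∈c with p ∈? c
... | yes _  = refl
... | no p∉c = contradiction p∈c p∉c

lruStep-hit : ∀ k c p → p ∈ c → lruStep k c p ≡ p ∷ remove p c
lruStep-hit k c p p∈c with p ∈? c
... | yes _  = refl
... | no p∉c = contradiction p∈c p∉c

fwfStep-hit : ∀ k d p → p ∈ d → fwfStep k d p ≡ d
fwfStep-hit k d p p∈d with p ∈? d
... | yes _  = refl
... | no p∉d = contradiction p∈d p∉d

fwfStep-room : ∀ k d p → p ∉ d → length d < k → fwfStep k d p ≡ p ∷ d
fwfStep-room k d p p∉d room with p ∈? d
... | yes p∈d = contradiction p∈d p∉d
... | no _ with length d <? k
...   | yes _   = refl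
...   | no full = contradiction room full

fwfStep-flush : ∀ k d p → p ∉ d → ¬ (length d < k) → fwfStep k d p ≡ p ∷ []
fwfStep-flush k d p p∉d full with p ∈? d
... | yes p∈d = contradiction p∈d p∉d
... | no _ with length d <? k
...   | yes room = contradiction room full
...   | no _     = refl

runFaults-hit : ∀ A k c p J {c′} → p ∈ c → A k c p ≡ c′ →
  runFaults A k c (p ∷ J) ≡ runFaults A k c′ J
runFaults-hit A k c p J p∈c step with p ∈? c
... | yes _  = cong (λ c″ → runFaults A k c″ J) step
... | no p∉c = contradiction p∈c p∉c

runFaults-miss : ∀ A k c p J {c′} → p ∉ c → A k c p ≡ c′ →
  runFaults A k c (p ∷ J) ≡ suc (runFaults A k c′ J)
runFaults-miss A k c p J p∉c step with p ∈? c
... | yes p∈c = contradiction p∈c p∉c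
... | no _    = cong (λ c″ → suc (runFaults A k c″ J)) step

admits-miss : ∀ {A} → Admits A → ∀ k c p J → p ∉ c →
  runFaults A k c (p ∷ J) ≡ suc (runFaults A k (admit k c p) J)
admits-miss {A} adm k c p J p∉c = runFaults-miss A k c p J p∉c (adm k c p p∉c)

fifo-hit : ∀ k c p J → p ∈ c → runFaults fifoStep k c (p ∷ J) ≡ runFaults fifoStep k c J
fifo-hit k c p J p∈c = runFaults-hit fifoStep k c p J p∈c (fifoStep-hit k c p p∈c)

lru-hit : ∀ k c p J → p ∈ c →
  runFaults lruStep k c (p ∷ J) ≡ runFaults lruStep k (p ∷ remove p c) J
lru-hit k c p J p∈c = runFaults-hit lruStep k c p J p∈c (lruStep-hit k c p p∈c)

fwf-hit : ∀ k d p J → p ∈ d → runFaults fwfStep k d (p ∷ J) ≡ runFaults fwfStep k d J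
fwf-hit k d p J p∈d = runFaults-hit fwfStep k d p J p∈d (fwfStep-hit k d p p∈d)

fwf-room : ∀ k d p J → p ∉ d → length d < k →
  runFaults fwfStep k d (p ∷ J) ≡ suc (runFaults fwfStep k (p ∷ d) J)
fwf-room k d p J p∉d room = runFaults-miss fwfStep k d p J p∉d (fwfStep-room k d p p∉d room)

fwf-flush : ∀ k d p J → p ∉ d → ¬ (length d < k) →
  runFaults fwfStep k d (p ∷ J) ≡ suc (runFaults fwfStep k (p ∷ []) J)
fwf-flush k d p J p∉d full = runFaults-miss fwfStep k d p J p∉d (fwfStep-flush k d p p∉d full)

fifo-simulates : ∀ k → 1 ≤ k → (J L R d : List Page) → Unique L → L ⊆ d → length d ≤ k →
  runFaults fifoStep k (L ++ R) J + length L ≤ runFaults fwfStep k d J + length d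
fifo-simulates k k≥1 [] L R d uL L⊆d _ = unique-⊆-length uL L⊆d
fifo-simulates k k≥1 (p ∷ J) L R d uL L⊆d |d|≤k =
  step (p ∈? (L ++ R)) (p ∈? d) (length d <? k)
  where
  |L|≤|d| : length L ≤ length d
  |L|≤|d| = unique-⊆-length uL L⊆d

  fresh : p ∉ L ++ R → Unique (p ∷ L)
  fresh p∉c = unique-∷ (λ p∈L → p∉c (∈-++⁺ˡ p∈L)) uL

  shift : ∀ {m n o q} → m + suc n ≤ o + suc q → suc m + n ≤ suc o + q
  shift {m} {n} {o} {q} le = ≤-trans (≤-reflexive (sym (+-suc m n))) (≤-trans le (≤-reflexive (+-suc o q)))

  step : Dec (p ∈ L ++ R) → Dec (p ∈ d) → Dec (length d < k) →
    runFaults fifoStep k (L ++ R) (p ∷ J) + length L ≤ runFaults fwfStep k d (p ∷ J) + length d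
  step (yes p∈c) (yes p∈d) _
    rewrite fifo-hit k (L ++ R) p J p∈c | fwf-hit k d p J p∈d
    = fifo-simulates k k≥1 J L R d uL L⊆d |d|≤k
  -- Only FWF faults and loads p: |d| grows, paying for FWF's fault.
  step (yes p∈c) (no p∉d) (yes room)
    rewrite fifo-hit k (L ++ R) p J p∈c | fwf-room k d p J p∉d room
    = ≤-trans (fifo-simulates k k≥1 J L R (p ∷ d) uL (⊆-trans L⊆d (xs⊆x∷xs d p)) room)
              (≤-reflexive (+-suc _ (length d)))
  step (yes p∈c) (no p∉d) (no full)
    rewrite fifo-hit k (L ++ R) p J p∈c | fwf-flush k d p J p∉d full
    = +-mono-≤ (subst₂ _≤_ (+-identityʳ _) (+-comm _ 1)
                 (fifo-simulates k k≥1 J [] (L ++ R) (p ∷ []) [] (λ ()) k≥1))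
               |L|≤|d|
  -- Only FIFO faults: p ∈ d ∖ L, so |p ∷ L| ≤ |d| ≤ k and p joins L.
  step (no p∉c) (yes p∈d) _
    rewrite admits-miss fifo-admits k (L ++ R) p J p∉c | fwf-hit k d p J p∈d
    with admit-prefix k L R p (≤-trans (unique-⊆-length (fresh p∉c) (∈-∷⁺ʳ p∈d L⊆d)) |d|≤k)
  ... | R′ , eq rewrite eq
    = ≤-trans (≤-reflexive (sym (+-suc _ (length L))))
              (fifo-simulates k k≥1 J (p ∷ L) R′ d (fresh p∉c)
                              (∈-∷⁺ʳ p∈d L⊆d) |d|≤k)
  step (no p∉c) (no p∉d) (yes room)
    rewrite admits-miss fifo-admits k (L ++ R) p J p∉c | fwf-room k d p J p∉d room
    with admit-prefix k L R p (≤-<-trans |L|≤|d| room)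
  ... | R′ , eq rewrite eq
    = shift (fifo-simulates k k≥1 J (p ∷ L) R′ (p ∷ d) (fresh p∉c)
                            (∷⁺ʳ p L⊆d) room)
  step (no p∉c) (no p∉d) (no full)
    rewrite admits-miss fifo-admits k (L ++ R) p J p∉c | fwf-flush k d p J p∉d full
    with admit-prefix k [] (L ++ R) p k≥1
  ... | R′ , eq rewrite eq
    = s≤s (+-mono-≤ (+-cancelʳ-≤ 1 _ _ (fifo-simulates k k≥1 J (p ∷ []) R′ (p ∷ [])
                                          (unique-∷ (λ ()) []) ⊆-refl k≥1))
                    |L|≤|d|)

lru-simulates : ∀ k → 1 ≤ k → (J L R d : List Page) →
  Unique L → L ⊆ d → d ⊆ L → length d ≤ k →
  runFaults lruStep k (L ++ R) J ≤ runFaults fwfStep k d J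
lru-simulates k k≥1 [] L R d _ _ _ _ = z≤n
lru-simulates k k≥1 (p ∷ J) L R d uL L⊆d d⊆L |d|≤k =
  step (p ∈? (L ++ R)) (p ∈? d) (length d <? k)
  where
  -- An LRU hit moves p to the front: the new prefix is p ∷ remove p L.
  front-unique : Unique (p ∷ remove p L)
  front-unique = unique-∷ (∉-remove p L) (remove-unique p uL)

  front-⊆ : ∀ {d′} → p ∈ d′ → d ⊆ d′ → p ∷ remove p L ⊆ d′
  front-⊆ p∈d′ d⊆d′ = ∈-∷⁺ʳ p∈d′ (⊆-trans (⊆-trans (∈-remove⁻ L) L⊆d) d⊆d′)

  new-phase : ∀ R′ → runFaults lruStep k (p ∷ R′) J ≤ runFaults fwfStep k (p ∷ []) J
  new-phase R′ = lru-simulates k k≥1 J (p ∷ []) R′ (p ∷ []) (unique-∷ (λ ()) []) ⊆-refl ⊆-refl k≥1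

  step : Dec (p ∈ L ++ R) → Dec (p ∈ d) → Dec (length d < k) →
    runFaults lruStep k (L ++ R) (p ∷ J) ≤ runFaults fwfStep k d (p ∷ J)
  step (yes p∈c) (yes p∈d) _
    rewrite lru-hit k (L ++ R) p J p∈c | fwf-hit k d p J p∈d | remove-++ p L R
    = lru-simulates k k≥1 J (p ∷ remove p L) (remove p R) d
        front-unique (front-⊆ p∈d ⊆-refl) (⊆-to-front d⊆L) |d|≤k
  step (yes p∈c) (no p∉d) (yes room)
    rewrite lru-hit k (L ++ R) p J p∈c | fwf-room k d p J p∉d room | remove-++ p L R
    = m≤n⇒m≤1+n (lru-simulates k k≥1 J (p ∷ remove p L) (remove p R) (p ∷ d)
        front-unique (front-⊆ (here refl) (xs⊆x∷xs d p)) (∈-∷⁺ʳ (here refl) (⊆-to-front d⊆L)) room)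
  step (yes p∈c) (no p∉d) (no full)
    rewrite lru-hit k (L ++ R) p J p∈c | fwf-flush k d p J p∉d full
    = m≤n⇒m≤1+n (new-phase (remove p (L ++ R)))
  step (no p∉c) (yes p∈d) _ = contradiction (∈-++⁺ˡ (d⊆L p∈d)) p∉c
  -- Both fault, FWF has room: |L| ≤ |d| < k, so p joins both L and d.
  step (no p∉c) (no p∉d) (yes room)
    rewrite admits-miss lru-admits k (L ++ R) p J p∉c | fwf-room k d p J p∉d room
    with admit-prefix k L R p (≤-<-trans (unique-⊆-length uL L⊆d) room)
  ... | R′ , eq rewrite eq
    = s≤s (lru-simulates k k≥1 J (p ∷ L) R′ (p ∷ d)
        (unique-∷ (λ p∈L → p∉c (∈-++⁺ˡ p∈L)) uL) (∷⁺ʳ p L⊆d) (∷⁺ʳ p d⊆L) room)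
  step (no p∉c) (no p∉d) (no full)
    rewrite admits-miss lru-admits k (L ++ R) p J p∉c | fwf-flush k d p J p∉d full
    with admit-prefix k [] (L ++ R) p k≥1
  ... | R′ , eq rewrite eq = s≤s (new-phase R′)

fifo≤fwf : ∀ k → 1 ≤ k → ∀ J → faults fifoStep k J ≤ faults fwfStep k J
fifo≤fwf k k≥1 J = +-cancelʳ-≤ 0 _ _ (fifo-simulates k k≥1 J [] [] [] [] ⊆-refl z≤n)

lru≤fwf : ∀ k → 1 ≤ k → ∀ J → faults lruStep k J ≤ faults fwfStep k J
lru≤fwf k k≥1 J = lru-simulates k k≥1 J [] [] [] [] ⊆-refl ⊆-refl z≤n

maximum-mono : ∀ {A : Set} (f g : A → ℕ) → (∀ x → f x ≤ g x) →
  ∀ xs → maximum (map f xs) ≤ maximum (map g xs)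
maximum-mono f g f≤g []       = z≤n
maximum-mono f g f≤g (x ∷ xs) = ⊔-mono-≤ (f≤g x) (maximum-mono f g f≤g xs)

worst-mono : ∀ A B k → (∀ J → faults A k J ≤ faults B k J) → ∀ I → worst A k I ≤ worst B k I
worst-mono A B k A≤B I = maximum-mono (faults A k) (faults B k) A≤B (permutations I)

corollary2 : (k : ℕ) → k ≥ 1 → (I : Request) →
    (worst fifoStep k I ≤ worst fwfStep k I) × (worst lruStep k I ≤ worst fwfStep k I)
corollary2 k k≥1 I =
  worst-mono fifoStep fwfStep k (fifo≤fwf k k≥1) I , worst-mono lruStep fwfStep k (lru≤fwf k k≥1) I
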